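{- Let $f:K\to\mathbb{F}_2$ be a Niho bent function and let $g:S\to F$ be the function with $f(\lambda u)=tr(\lambda g(u))$ for all $\lambda\in F$, $u\in S$. Then the dual of $f$ is $$\tilde f(x)=\prod_{u\in S}\bigl(T(xu)+g(u)\bigr)^{q-1}\qquad (x\in K),$$ where the right-hand side lies in $\{0,1\}\subseteq F$ and is identified with an element of $\mathbb{F}_2$.
   Context: Let $m\ge1$, $q=2^m$, $F=\mathbb{F}_{q}\subseteq K=\mathbb{F}_{q^2}$, $\bar x=x^q$, $T(x)=x+\bar x$, $tr:F\to\mathbb{F}_2$ and $Tr:K\to\mathbb{F}_2$ absolute traces, $S=\{u\in K:u\bar u=1\}$ (every nonzero $x\in K$ is uniquely $\lambda u$ with $\lambda\in F^*$, $u\in S$). A function $f:K\to\mathbb{F}_2$ is bent if $W_f(b)=\sum_{x\in K}(-1)^{f(x)+Tr(bx)}=\pm q$ for all $b\in K$, with dual $\tilde f$ defined by $W_f(b)=(-1)^{\tilde f(b)}q$. A Niho bent function is a bent function $f:K\to\mathbb{F}_2$ whose restriction to each set $uF=\{\lambda u:\lambda\in F\}$, $u\in S$, is $\mathbb{F}_2$-linear; for such $f$ there is a unique $g:S\to F$ with $f(\lambda u)=tr(\lambda g(u))$. -}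

module Defs where

open import Level using (0ℓ)
open import Data.Nat as ℕ using (ℕ; zero; suc)
open import Data.Bool using (Bool; true; false; not; _xor_)
open import Data.Fin using (Fin)
open import Data.List as List using (List; map; filter; foldr; allFin; upTo)
open import Data.Integer as ℤ using (ℤ)
open import Data.Product using (∃)
open import Relation.Nullary using (¬_; does)
open import Relation.Binary using (Decidable)
open import Relation.Binary.PropositionalEquality using (_≡_)
open import Algebra.Structures using (IsCommutativeRing)
open import Function.Definitions using (Injective; Surjective)

record FiniteField (n : ℕ) : Set₁ where
  infixl 6 _+_
  infixl 7 _*_
  field
    Carrier : Set
    _+_ _*_ : Carrier → Carrier → Carrier
    -_ : Carrier → Carrier
    0# 1# : Carrier
    isCommutativeRing : IsCommutativeRing _≡_ _+_ _*_ -_ 0# 1#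
    0≢1 : ¬ (0# ≡ 1#)
    inverse : ∀ x → ¬ (x ≡ 0#) → ∃ λ y → x * y ≡ 1#
    _≟_ : Decidable {A = Carrier} _≡_
    enum : Fin n → Carrier
    enum-injective : Injective _≡_ _≡_ enum
    enum-surjective : Surjective _≡_ _≡_ enum

module Ops {n : ℕ} (K : FiniteField n) where
  open FiniteField K public

  _^_ : Carrier → ℕ → Carrier
  x ^ zero = 1#
  x ^ suc k = x * (x ^ k)

  sumK : List Carrier → Carrier
  sumK = foldr _+_ 0#

  prodK : List Carrier → Carrier
  prodK = foldr _*_ 1#

  elements : List Carrier
  elements = map enum (allFin n)

  -- identification of {0,1} ⊆ K with 𝔽₂ (0 ↦ false, anything else ↦ true)
  toBit : Carrier → Bool
  toBit y = not (does (y ≟ 0#))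

  module WithQ (m : ℕ) where
    q : ℕ
    q = 2 ℕ.^ m

    conj : Carrier → Carrier
    conj x = x ^ q

    T : Carrier → Carrier
    T x = x + conj x

    InF : Carrier → Set
    InF x = x ^ q ≡ x

    InS : Carrier → Set
    InS u = u * conj u ≡ 1#

    S-elements : List Carrier
    S-elements = filter (λ u → (u * conj u) ≟ 1#) elements

    tr : Carrier → Bool
    tr x = toBit (sumK (map (λ i → x ^ (2 ℕ.^ i)) (upTo m)))

    Tr : Carrier → Bool
    Tr x = toBit (sumK (map (λ i → x ^ (2 ℕ.^ i)) (upTo (m ℕ.+ m))))

    sign : Bool → ℤ
    sign false = ℤ.+ 1
    sign true = ℤ.- (ℤ.+ 1)

    W : (Carrier → Bool) → Carrier → ℤ
    W f b = List.foldr ℤ._+_ (ℤ.+ 0) (map (λ x → sign (f x xor Tr (b * x))) elements)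

    IsBent : (Carrier → Bool) → Set
    IsBent f = ∀ b → (W f b ≡ ℤ.+ q) Data.Sum.⊎ (W f b ≡ ℤ.- (ℤ.+ q))
      where import Data.Sum

    IsNihoBent : (Carrier → Bool) → Set
    IsNihoBent f = IsBent f Data.Product.×
      (∀ u → InS u → ∀ l μ → InF l → InF μ →
         f ((l + μ) * u) ≡ (f (l * u) xor f (μ * u)))
      where import Data.Product

module Submission where

open import Defs
open import Data.Nat using (ℕ; _≤_)
open import Data.Nat as ℕ using ()
open import Data.Bool using (Bool)
open import Data.Integer as ℤ using (ℤ)
open import Data.List using (map)
open import Data.Product using (_×_)
open import Data.Sum using (_⊎_)
open import Relation.Binary.PropositionalEquality using (_≡_)

open import Level using (0ℓ)
open import Data.Nat using (zero; suc; z≤n; s≤s)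
import Data.Nat.Properties as ℕP
import Data.Nat.Tactic.RingSolver as ℕSolver
open import Data.Nat.ListAction using (sum)
import Data.Integer.Properties as ℤP
open import Data.Integer.Tactic.RingSolver using (solve-∀)
open import Data.Bool using (true; false; not; _xor_; if_then_else_)
import Data.Bool as Bool
import Data.Bool.Properties as BoolP
open import Data.Product using (∃; ∃₂; _,_; proj₁; proj₂)
open import Data.Sum using (inj₁; inj₂)
open import Data.Empty using (⊥-elim)
open import Function.Base using (_∘_)
open import Function.Bundles using (mk⇔)
open import Relation.Nullary using (¬_; yes; no; ¬?; does; contradiction)
open import Relation.Unary using (Decidable)
open import Relation.Binary.Definitions using (DecidableEquality)
open import Relation.Binary.PropositionalEquality
  using (refl; sym; trans; cong; cong₂; subst; _≢_; module ≡-Reasoning)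
import Relation.Binary.PropositionalEquality as ≡
open import Algebra.Bundles using (CommutativeRing)
open import Algebra.Structures using (IsCommutativeRing; IsCommutativeMonoid)
open import Data.List
  using (List; []; _∷_; _++_; foldr; filter; length; allFin; upTo; applyUpTo; replicate; cartesianProduct)
import Data.List.Properties as LP
open import Data.List.Membership.Propositional using (_∈_; find; lose)
open import Data.List.Membership.Propositional.Properties
  using (∈-map⁺; ∈-map⁻; ∈-filter⁺; ∈-filter⁻; ∈-allFin; ∈-cartesianProduct⁺; ∈-cartesianProduct⁻)
open import Data.List.Membership.Propositional.Properties.WithK using (unique∧set⇒bag)
open import Data.List.Relation.Unary.All as All using (All; []; _∷_)
import Data.List.Relation.Unary.All.Properties as AllP
open import Data.List.Relation.Unary.AllPairs using ([]; _∷_)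
open import Data.List.Relation.Unary.Any as Any using (Any; here; there; any?)
open import Data.List.Relation.Unary.Unique.Propositional using (Unique)
import Data.List.Relation.Unary.Unique.Propositional.Properties as UniqueP
open import Data.List.Relation.Binary.BagAndSetEquality using (∼bag⇒↭)
open import Data.List.Relation.Binary.Permutation.Propositional using (_↭_; ↭⇒↭ₛ)
import Data.List.Relation.Binary.Permutation.Propositional.Properties as PermP
import Data.List.Relation.Binary.Permutation.Setoid.Properties as PermutationS

-- Since |K| = q² is even, −1 = (−1)^{q²} = 1: K has characteristic 2 and x ↦ x̄ = x^q is an
-- involutive automorphism with fixed field F. Every z ≠ 0 is uniquely λu with λ ∈ F*, u ∈ S
-- (λ² = z z̄), and counting the roots of x^{q−1} = 1 and x^{q+1} = 1 gives |F*| = q − 1 and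
-- |S| = q + 1. As f(λu) = tr(λ g(u)) and Tr(xλu) = tr(λ T(xu)), the Walsh sum over the line F*u is
-- Σ_{λ ∈ F*} (−1)^{tr(λ c_u)} with c_u = T(xu) + g(u) ∈ F, which is q − 1 if c_u = 0 and −1
-- otherwise, since tr is additive and (by bentness) not identically 0 on F. Hence
-- W_f(x) = q·#{u ∈ S : c_u = 0} − q. If some c_u vanishes, the product is 0 and W_f(x) ≠ −q,
-- so W_f(x) = q; otherwise every factor c_u^{q−1} is 1 and W_f(x) = −q.

module _ {A : Set} where

  unique∧set⇒↭ : {xs ys : List A} → Unique xs → Unique ys →
                 (∀ {z} → z ∈ xs → z ∈ ys) → (∀ {z} → z ∈ ys → z ∈ xs) → xs ↭ ys
  unique∧set⇒↭ uxs uys xs⊆ys ys⊆xs = ∼bag⇒↭ (unique∧set⇒bag uxs uys (mk⇔ xs⊆ys ys⊆xs))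

  map-inverse-↭ : (f g : A → A) → (∀ x → g (f x) ≡ x) → (∀ y → f (g y) ≡ y) →
                  {xs : List A} → Unique xs →
                  (∀ {x} → x ∈ xs → f x ∈ xs) → (∀ {y} → y ∈ xs → g y ∈ xs) → map f xs ↭ xs
  map-inverse-↭ f g g∘f f∘g {xs} uxs f-closed g-closed =
    unique∧set⇒↭ (UniqueP.map⁺ f-injective uxs) uxs image⊆xs xs⊆image
    where
      f-injective : ∀ {x y} → f x ≡ f y → x ≡ y
      f-injective {x} {y} e = trans (sym (g∘f x)) (trans (cong g e) (g∘f y))
      image⊆xs : ∀ {z} → z ∈ map f xs → z ∈ xs
      image⊆xs z∈ with ∈-map⁻ f z∈
      ... | _ , x∈ , refl = f-closed x∈
      xs⊆image : ∀ {z} → z ∈ xs → z ∈ map f xs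
      xs⊆image {z} z∈ = subst (_∈ map f xs) (f∘g z) (∈-map⁺ f (g-closed z∈))

  ↭-∷-filter-≢ : (_≟_ : DecidableEquality A) {a : A} {xs : List A} → Unique xs → a ∈ xs →
                 xs ↭ a ∷ filter (λ x → ¬? (x ≟ a)) xs
  ↭-∷-filter-≢ _≟_ {a} {xs} uxs a∈ =
    unique∧set⇒↭ uxs (a∉rest ∷ UniqueP.filter⁺ _ uxs) xs⊆
      (λ { (here refl) → a∈ ; (there z∈) → proj₁ (∈-filter⁻ _ {xs = xs} z∈) })
    where
      a∉rest : All (a ≢_) (filter (λ x → ¬? (x ≟ a)) xs)
      a∉rest = All.tabulate (λ z∈ a≡z → proj₂ (∈-filter⁻ _ {xs = xs} z∈) (sym a≡z))
      xs⊆ : ∀ {z} → z ∈ xs → z ∈ a ∷ filter (λ x → ¬? (x ≟ a)) xs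
      xs⊆ {z} z∈ with z ≟ a
      ... | yes refl = here refl
      ... | no z≢a = there (∈-filter⁺ _ z∈ z≢a)

module _ {A B : Set} where

  unique-map⁺-local : {f : A → B} {xs : List A} → (∀ {x y} → x ∈ xs → y ∈ xs → f x ≡ f y → x ≡ y) →
                      Unique xs → Unique (map f xs)
  unique-map⁺-local {xs = []} inj [] = []
  unique-map⁺-local {f} {x ∷ xs} inj (x∉ ∷ uxs) =
    AllP.map⁺ (All.tabulate (λ y∈ fx≡fy → All.lookup x∉ y∈ (inj (here refl) (there y∈) fx≡fy)))
    ∷ unique-map⁺-local (λ x∈ y∈ → inj (there x∈) (there y∈)) uxs

  length-cartesianProduct : (xs : List A) (ys : List B) →
                            length (cartesianProduct xs ys) ≡ length xs ℕ.* length ys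
  length-cartesianProduct [] ys = refl
  length-cartesianProduct (x ∷ xs) ys =
    trans (LP.length-++ (map (x ,_) ys)) (cong₂ ℕ._+_ (LP.length-map (x ,_) ys) (length-cartesianProduct xs ys))

module FoldCommutativeMonoid {A : Set} {_∙_ : A → A → A} {ε : A}
                             (isCommutativeMonoid : IsCommutativeMonoid _≡_ _∙_ ε) where
  open IsCommutativeMonoid isCommutativeMonoid using (assoc; identityˡ)

  fold : List A → A
  fold = foldr _∙_ ε

  fold-↭ : {xs ys : List A} → xs ↭ ys → fold xs ≡ fold ys
  fold-↭ p = PermutationS.foldr-commMonoid (≡.setoid A) isCommutativeMonoid (↭⇒↭ₛ p)

  fold-++ : (xs ys : List A) → fold (xs ++ ys) ≡ fold xs ∙ fold ys
  fold-++ [] ys = sym (identityˡ _)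
  fold-++ (x ∷ xs) ys = trans (cong (x ∙_) (fold-++ xs ys)) (sym (assoc _ _ _))

  fold-cartesianProduct : {B C : Set} (h : B × C → A) (bs : List B) (cs : List C) →
    fold (map h (cartesianProduct bs cs)) ≡ fold (map (λ b → fold (map (λ c → h (b , c)) cs)) bs)
  fold-cartesianProduct h [] cs = refl
  fold-cartesianProduct h (b ∷ bs) cs = begin
      fold (map h (map (b ,_) cs ++ cartesianProduct bs cs))
        ≡⟨ cong fold (LP.map-++ h (map (b ,_) cs) _) ⟩
      fold (map h (map (b ,_) cs) ++ map h (cartesianProduct bs cs))
        ≡⟨ fold-++ (map h (map (b ,_) cs)) (map h (cartesianProduct bs cs)) ⟩
      fold (map h (map (b ,_) cs)) ∙ fold (map h (cartesianProduct bs cs))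
        ≡⟨ cong₂ _∙_ (cong fold (sym (LP.map-∘ cs))) (fold-cartesianProduct h bs cs) ⟩
      fold (map (λ c → h (b , c)) cs) ∙ fold (map (λ b → fold (map (λ c → h (b , c)) cs)) bs) ∎
    where open ≡-Reasoning

∈⇒≤sum : ∀ {k ks} → k ∈ ks → k ≤ sum ks
∈⇒≤sum {k} {ks = k ∷ ks} (here refl) = ℕP.m≤m+n k (sum ks)
∈⇒≤sum {ks = k′ ∷ ks} (there k∈) = ℕP.≤-trans (∈⇒≤sum k∈) (ℕP.m≤n+m (sum ks) k′)

sum-map-≡0 : ∀ {A : Set} {h : A → ℕ} {xs} → All (λ x → h x ≡ 0) xs → sum (map h xs) ≡ 0
sum-map-≡0 [] = refl
sum-map-≡0 (hx≡0 ∷ rest) = cong₂ ℕ._+_ hx≡0 (sum-map-≡0 rest)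

*-≡-bounded⇒≡ : ∀ {a b} c d → a ≤ suc c → b ≤ suc d → a ℕ.* b ≡ suc c ℕ.* suc d → a ≡ suc c × b ≡ suc d
*-≡-bounded⇒≡ {a} {b} c d a≤ b≤ ab≡ = a≡ , b≡
  where
    b≡ : b ≡ suc d
    b≡ = ℕP.*-cancelˡ-≡ b (suc d) (suc c)
      (ℕP.≤-antisym (ℕP.*-monoʳ-≤ (suc c) b≤) (subst (ℕ._≤ suc c ℕ.* b) ab≡ (ℕP.*-monoˡ-≤ b a≤)))
    a≡ : a ≡ suc c
    a≡ = ℕP.*-cancelʳ-≡ a (suc c) (suc d) (subst (λ t → a ℕ.* t ≡ suc c ℕ.* suc d) b≡ ab≡)

i≡-i⇒i≡0 : ∀ {i} → i ≡ ℤ.- i → i ≡ ℤ.+ 0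
i≡-i⇒i≡0 {ℤ.+ zero} _ = refl
i≡-i⇒i≡0 {ℤ.+ suc n} ()
i≡-i⇒i≡0 {ℤ.-[1+ n ]} ()

i-j≡-j⇒i≡0 : ∀ {i j} → i ℤ.- j ≡ ℤ.- j → i ≡ ℤ.+ 0
i-j≡-j⇒i≡0 {i} {j} i-j≡-j = begin
    i                   ≡⟨ regroup i j ⟩
    (i ℤ.- j) ℤ.+ j     ≡⟨ cong (ℤ._+ j) i-j≡-j ⟩
    ℤ.- j ℤ.+ j         ≡⟨ ℤP.+-inverseˡ j ⟩
    ℤ.+ 0               ∎
  where
    open ≡-Reasoning
    regroup : ∀ i j → i ≡ (i ℤ.- j) ℤ.+ j
    regroup = solve-∀

module IntegerSums where
  open FoldCommutativeMonoid ℤP.+-0-isCommutativeMonoid public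
    using () renaming (fold to sumℤ; fold-↭ to sumℤ-↭; fold-cartesianProduct to sumℤ-cartesianProduct)

  sumℤ-map-neg : ∀ {A : Set} (h : A → ℤ) xs → sumℤ (map (λ x → ℤ.- h x) xs) ≡ ℤ.- sumℤ (map h xs)
  sumℤ-map-neg h [] = refl
  sumℤ-map-neg h (x ∷ xs) = trans (cong (ℤ._+_ (ℤ.- h x)) (sumℤ-map-neg h xs)) (sym (ℤP.neg-distrib-+ (h x) _))

  sumℤ-map-1 : ∀ {A : Set} (xs : List A) → sumℤ (map (λ _ → ℤ.+ 1) xs) ≡ ℤ.+ length xs
  sumℤ-map-1 [] = refl
  sumℤ-map-1 (x ∷ xs) = trans (cong (ℤ._+_ (ℤ.+ 1)) (sumℤ-map-1 xs)) (sym (ℤP.pos-+ 1 (length xs)))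

  sumℤ-map-pred : ∀ {A : Set} (h : A → ℕ) xs →
                  sumℤ (map (λ x → ℤ.+ h x ℤ.- ℤ.+ 1) xs) ≡ ℤ.+ sum (map h xs) ℤ.- ℤ.+ length xs
  sumℤ-map-pred h [] = refl
  sumℤ-map-pred h (x ∷ xs) = begin
      (ℤ.+ h x ℤ.- ℤ.+ 1) ℤ.+ sumℤ (map (λ x → ℤ.+ h x ℤ.- ℤ.+ 1) xs)
        ≡⟨ cong (ℤ._+_ (ℤ.+ h x ℤ.- ℤ.+ 1)) (sumℤ-map-pred h xs) ⟩
      (ℤ.+ h x ℤ.- ℤ.+ 1) ℤ.+ (ℤ.+ s ℤ.- ℤ.+ length xs)
        ≡⟨ regroup (ℤ.+ h x) (ℤ.+ s) (ℤ.+ length xs) ⟩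
      (ℤ.+ h x ℤ.+ ℤ.+ s) ℤ.- (ℤ.+ 1 ℤ.+ ℤ.+ length xs)
        ≡⟨ cong₂ ℤ._-_ (sym (ℤP.pos-+ (h x) s)) (sym (ℤP.pos-+ 1 (length xs))) ⟩
      ℤ.+ (h x ℕ.+ s) ℤ.- ℤ.+ suc (length xs) ∎
    where
      open ≡-Reasoning
      s : ℕ
      s = sum (map h xs)
      regroup : ∀ a b c → (a ℤ.- ℤ.+ 1) ℤ.+ (b ℤ.- c) ≡ (a ℤ.+ b) ℤ.- (ℤ.+ 1 ℤ.+ c)
      regroup = solve-∀

module FiniteFieldProperties {n : ℕ} (K : FiniteField n) where
  open Ops K
  open IsCommutativeRing isCommutativeRing
    using (+-assoc; +-comm; +-identityˡ; +-identityʳ; *-assoc; *-comm; *-identityˡ; *-identityʳ;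
           zeroˡ; zeroʳ; -‿inverseˡ; -‿inverseʳ; *-isCommutativeMonoid; +-isCommutativeMonoid)

  commutativeRing : CommutativeRing 0ℓ 0ℓ
  commutativeRing = record { isCommutativeRing = isCommutativeRing }

  open import Algebra.Solver.Ring.NaturalCoefficients.Default (CommutativeRing.commutativeSemiring commutativeRing)
    using (solve; _:=_; _:+_; _:*_; con)
  import Algebra.Properties.Ring (CommutativeRing.ring commutativeRing) as RingProperties
  open FoldCommutativeMonoid *-isCommutativeMonoid using () renaming (fold-↭ to prodK-↭)
  open FoldCommutativeMonoid +-isCommutativeMonoid using () renaming (fold-++ to sumK-++)

  ^-homo-* : ∀ x a b → x ^ (a ℕ.+ b) ≡ x ^ a * x ^ b
  ^-homo-* x zero b = sym (*-identityˡ _)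
  ^-homo-* x (suc a) b = trans (cong (x *_) (^-homo-* x a b)) (sym (*-assoc _ _ _))

  ^-zeroˡ : ∀ k → 1# ^ k ≡ 1#
  ^-zeroˡ zero = refl
  ^-zeroˡ (suc k) = trans (*-identityˡ _) (^-zeroˡ k)

  ^-distrib-* : ∀ x y k → (x * y) ^ k ≡ x ^ k * y ^ k
  ^-distrib-* x y zero = sym (*-identityˡ 1#)
  ^-distrib-* x y (suc k) = trans (cong ((x * y) *_) (^-distrib-* x y k))
    (solve 4 (λ x y a b → (x :* y) :* (a :* b) := (x :* a) :* (y :* b)) refl x y (x ^ k) (y ^ k))

  ^-assocʳ : ∀ x a b → (x ^ a) ^ b ≡ x ^ (a ℕ.* b)
  ^-assocʳ x zero b = ^-zeroˡ b
  ^-assocʳ x (suc a) b = begin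
      (x * x ^ a) ^ b       ≡⟨ ^-distrib-* x (x ^ a) b ⟩
      x ^ b * (x ^ a) ^ b   ≡⟨ cong (x ^ b *_) (^-assocʳ x a b) ⟩
      x ^ b * x ^ (a ℕ.* b) ≡⟨ sym (^-homo-* x b (a ℕ.* b)) ⟩
      x ^ (b ℕ.+ a ℕ.* b)   ∎
    where open ≡-Reasoning

  x*y≡1⇒y*[x*w]≡w : ∀ {x y} → x * y ≡ 1# → ∀ w → y * (x * w) ≡ w
  x*y≡1⇒y*[x*w]≡w {x} {y} xy≡1 w = trans (solve 3 (λ x y w → y :* (x :* w) := (x :* y) :* w) refl x y w)
                                         (trans (cong (_* w) xy≡1) (*-identityˡ w))

  *-cancelˡ : ∀ {x y z} → x ≢ 0# → x * y ≡ x * z → y ≡ z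
  *-cancelˡ {x} {y} {z} x≢0 xy≡xz with inverse x x≢0
  ... | x⁻¹ , xx⁻¹≡1 = trans (sym (x*y≡1⇒y*[x*w]≡w xx⁻¹≡1 y))
                             (trans (cong (x⁻¹ *_) xy≡xz) (x*y≡1⇒y*[x*w]≡w xx⁻¹≡1 z))

  *-≢0 : ∀ {x y} → x ≢ 0# → y ≢ 0# → x * y ≢ 0#
  *-≢0 {x} x≢0 y≢0 xy≡0 = y≢0 (*-cancelˡ x≢0 (trans xy≡0 (sym (zeroʳ x))))

  x*y≡1⇒x≢0 : ∀ {x y} → x * y ≡ 1# → x ≢ 0#
  x*y≡1⇒x≢0 {x} {y} xy≡1 x≡0 = 0≢1 (trans (sym (zeroˡ y)) (trans (cong (_* y) (sym x≡0)) xy≡1))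

  ^-≢0 : ∀ {x} k → x ≢ 0# → x ^ k ≢ 0#
  ^-≢0 zero x≢0 1≡0 = 0≢1 (sym 1≡0)
  ^-≢0 (suc k) x≢0 = *-≢0 x≢0 (^-≢0 k x≢0)

  x*y≡0⇒x≡0⊎y≡0 : ∀ {x y} → x * y ≡ 0# → x ≡ 0# ⊎ y ≡ 0#
  x*y≡0⇒x≡0⊎y≡0 {x} {y} xy≡0 with x ≟ 0# | y ≟ 0#
  ... | yes x≡0 | _ = inj₁ x≡0
  ... | no _ | yes y≡0 = inj₂ y≡0
  ... | no x≢0 | no y≢0 = ⊥-elim (*-≢0 x≢0 y≢0 xy≡0)

  x-y≡0⇒x≡y : ∀ {x y} → x + - y ≡ 0# → x ≡ y
  x-y≡0⇒x≡y {x} {y} = RingProperties.x∙y⁻¹≈ε⇒x≈y x y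

  elements-unique : Unique elements
  elements-unique = UniqueP.map⁺ enum-injective (UniqueP.allFin⁺ n)

  ∈-elements : ∀ z → z ∈ elements
  ∈-elements z with enum-surjective z
  ... | i , enum-i≡z = subst (_∈ elements) (enum-i≡z refl) (∈-map⁺ enum (∈-allFin i))

  length-elements : length elements ≡ n
  length-elements = trans (LP.length-map enum (allFin n)) (LP.length-tabulate (λ i → i))

  nonzero? : Decidable (_≢ 0#)
  nonzero? x = ¬? (x ≟ 0#)

  units : List Carrier
  units = filter nonzero? elements

  units-unique : Unique units
  units-unique = UniqueP.filter⁺ nonzero? elements-unique

  ∈-units⁺ : ∀ {x} → x ≢ 0# → x ∈ units
  ∈-units⁺ {x} = ∈-filter⁺ nonzero? (∈-elements x)

  ∈-units⁻ : ∀ {x} → x ∈ units → x ≢ 0#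
  ∈-units⁻ x∈ = proj₂ (∈-filter⁻ nonzero? {xs = elements} x∈)

  elements↭0∷units : elements ↭ 0# ∷ units
  elements↭0∷units = ↭-∷-filter-≢ _≟_ elements-unique (∈-elements 0#)

  scaling-↭ : ∀ {a b} → a * b ≡ 1# → {xs : List Carrier} → Unique xs →
              (∀ {y} → y ∈ xs → a * y ∈ xs) → (∀ {y} → y ∈ xs → b * y ∈ xs) → map (a *_) xs ↭ xs
  scaling-↭ {a} {b} ab≡1 =
    map-inverse-↭ (a *_) (b *_) (x*y≡1⇒y*[x*w]≡w ab≡1) (x*y≡1⇒y*[x*w]≡w (trans (*-comm b a) ab≡1))

  prodK-map-≡0 : ∀ {A : Set} {h : A → Carrier} {xs} → Any (λ x → h x ≡ 0#) xs → prodK (map h xs) ≡ 0#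
  prodK-map-≡0 {h = h} {x ∷ xs} (here hx≡0) = trans (cong (_* prodK (map h xs)) hx≡0) (zeroˡ _)
  prodK-map-≡0 {h = h} {x ∷ xs} (there some) = trans (cong (h x *_) (prodK-map-≡0 some)) (zeroʳ _)

  prodK-map-≡1 : ∀ {A : Set} {h : A → Carrier} {xs} → All (λ x → h x ≡ 1#) xs → prodK (map h xs) ≡ 1#
  prodK-map-≡1 [] = refl
  prodK-map-≡1 (hx≡1 ∷ rest) = trans (cong₂ _*_ hx≡1 (prodK-map-≡1 rest)) (*-identityˡ 1#)

  prodK-map-* : ∀ a xs → prodK (map (a *_) xs) ≡ a ^ length xs * prodK xs
  prodK-map-* a [] = sym (*-identityˡ _)
  prodK-map-* a (x ∷ xs) = trans (cong ((a * x) *_) (prodK-map-* a xs))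
    (solve 4 (λ a x p r → (a :* x) :* (p :* r) := (a :* p) :* (x :* r)) refl a x (a ^ length xs) (prodK xs))

  card≡1+|units| : n ≡ suc (length units)
  card≡1+|units| = trans (sym length-elements) (PermP.↭-length elements↭0∷units)

  prodK-≢0 : ∀ xs → (∀ {y} → y ∈ xs → y ≢ 0#) → prodK xs ≢ 0#
  prodK-≢0 [] _ 1≡0 = 0≢1 (sym 1≡0)
  prodK-≢0 (y ∷ ys) nz = *-≢0 (nz (here refl)) (prodK-≢0 ys (λ y∈ → nz (there y∈)))

  -- Multiplying by x permutes the units, so their product P satisfies x^|K*| P = P.
  ^-|units|≡1 : ∀ {x} → x ≢ 0# → x ^ length units ≡ 1#
  ^-|units|≡1 {x} x≢0 with inverse x x≢0
  ... | x⁻¹ , xx⁻¹≡1 = *-cancelˡ (prodK-≢0 units ∈-units⁻) (begin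
      prodK units * x ^ length units   ≡⟨ *-comm _ _ ⟩
      x ^ length units * prodK units   ≡⟨ sym (prodK-map-* x units) ⟩
      prodK (map (x *_) units)         ≡⟨ prodK-↭ (scaling-↭ xx⁻¹≡1 units-unique (scaled x≢0) (scaled x⁻¹≢0)) ⟩
      prodK units                      ≡⟨ sym (*-identityʳ _) ⟩
      prodK units * 1#                 ∎)
    where
      open ≡-Reasoning
      x⁻¹≢0 : x⁻¹ ≢ 0#
      x⁻¹≢0 = x*y≡1⇒x≢0 (trans (*-comm x⁻¹ x) xx⁻¹≡1)
      scaled : ∀ {a} → a ≢ 0# → ∀ {y} → y ∈ units → a * y ∈ units
      scaled a≢0 y∈ = ∈-units⁺ (*-≢0 a≢0 (∈-units⁻ y∈))

  ^-card : ∀ x → x ^ n ≡ x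
  ^-card x with x ≟ 0#
  ... | yes refl = subst (λ k → 0# ^ k ≡ 0#) (sym card≡1+|units|) (zeroˡ _)
  ... | no x≢0 = trans (cong (x ^_) card≡1+|units|)
                       (trans (cong (x *_) (^-|units|≡1 x≢0)) (*-identityʳ x))

  1+1≡0 : ∀ k → n ≡ 2 ℕ.* k → 1# + 1# ≡ 0#
  1+1≡0 k n≡2k = begin
      1# + 1#                ≡⟨ cong (_+ 1#) (sym -1≡1) ⟩
      - 1# + 1#              ≡⟨ -‿inverseˡ 1# ⟩
      0#                     ∎
    where
      open ≡-Reasoning
      square-of-minus-one : (- 1#) ^ 2 ≡ 1#
      square-of-minus-one = begin
          - 1# * (- 1# * 1#)   ≡⟨ cong (- 1# *_) (*-identityʳ (- 1#)) ⟩
          - 1# * - 1#          ≡⟨ RingProperties.-1*x≈-x (- 1#) ⟩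
          - - 1#               ≡⟨ RingProperties.-‿involutive 1# ⟩
          1#                   ∎
      -1≡1 : - 1# ≡ 1#
      -1≡1 = begin
          - 1#                     ≡⟨ sym (^-card (- 1#)) ⟩
          (- 1#) ^ n               ≡⟨ cong ((- 1#) ^_) n≡2k ⟩
          (- 1#) ^ (2 ℕ.* k)       ≡⟨ sym (^-assocʳ (- 1#) 2 k) ⟩
          ((- 1#) ^ 2) ^ k         ≡⟨ cong (_^ k) square-of-minus-one ⟩
          1# ^ k                   ≡⟨ ^-zeroˡ k ⟩
          1#                       ∎

  -- The list c₀ ∷ … ∷ c_{d-1} stands for the monic polynomial c₀ + c₁x + … + c_{d-1}x^{d-1} + x^d.
  evalMonic : List Carrier → Carrier → Carrier
  evalMonic [] x = 1#
  evalMonic (c ∷ cs) x = c + x * evalMonic cs x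

  quotient : List Carrier → Carrier → List Carrier
  quotient [] r = []
  quotient (c ∷ cs) r = evalMonic (c ∷ cs) r ∷ quotient cs r

  length-quotient : ∀ cs r → length (quotient cs r) ≡ length cs
  length-quotient [] r = refl
  length-quotient (c ∷ cs) r = cong suc (length-quotient cs r)

  -- The semiring solver treats - r as an opaque variable; adding (r + - r) * a = 0 supplies the cancellation.
  y≡y+[r-r]a : ∀ {r} y a → y ≡ y + (r + - r) * a
  y≡y+[r-r]a {r} y a =
    sym (trans (cong (λ t → y + t * a) (-‿inverseʳ r)) (trans (cong (y +_) (zeroˡ a)) (+-identityʳ y)))

  evalMonic-quotient : ∀ c cs r x →
                       evalMonic (c ∷ cs) x ≡ (x + - r) * evalMonic (quotient cs r) x + evalMonic (c ∷ cs) r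
  evalMonic-quotient c [] r x = begin
      c + x * 1#
        ≡⟨ y≡y+[r-r]a (c + x * 1#) 1# ⟩
      c + x * 1# + (r + - r) * 1#
        ≡⟨ solve 4 (λ c x r -r → c :+ x :* con 1 :+ (r :+ -r) :* con 1
                                  := (x :+ -r) :* con 1 :+ (c :+ r :* con 1)) refl c x r (- r) ⟩
      (x + - r) * 1# + (c + r * 1#) ∎
    where open ≡-Reasoning
  evalMonic-quotient c (c′ ∷ cs) r x = begin
      c + x * evalMonic (c′ ∷ cs) x
        ≡⟨ cong (λ t → c + x * t) (evalMonic-quotient c′ cs r x) ⟩
      c + x * ((x + - r) * h + a)
        ≡⟨ y≡y+[r-r]a (c + x * ((x + - r) * h + a)) a ⟩
      c + x * ((x + - r) * h + a) + (r + - r) * a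
        ≡⟨ solve 6 (λ c x r -r h a → c :+ x :* ((x :+ -r) :* h :+ a) :+ (r :+ -r) :* a
                                     := (x :+ -r) :* (a :+ x :* h) :+ (c :+ r :* a)) refl c x r (- r) h a ⟩
      (x + - r) * (a + x * h) + (c + r * a) ∎
    where
      open ≡-Reasoning
      a h : Carrier
      a = evalMonic (c′ ∷ cs) r
      h = evalMonic (quotient cs r) x

  roots-length≤degree : ∀ cs {rs} → Unique rs → All (λ r → evalMonic cs r ≡ 0#) rs → length rs ≤ length cs
  roots-length≤degree cs [] [] = z≤n
  roots-length≤degree [] (_ ∷ _) (1≡0 ∷ _) = ⊥-elim (0≢1 (sym 1≡0))
  roots-length≤degree (c ∷ cs) {r ∷ rs} (r∉rs ∷ urs) (r-root ∷ rs-roots) =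
    s≤s (subst (length rs ≤_) (length-quotient cs r)
      (roots-length≤degree (quotient cs r) urs
        (All.zipWith (λ (r≢r′ , r′-root) → quotient-root r≢r′ r′-root) (r∉rs , rs-roots))))
    where
      quotient-root : ∀ {r′} → r ≢ r′ → evalMonic (c ∷ cs) r′ ≡ 0# → evalMonic (quotient cs r) r′ ≡ 0#
      quotient-root {r′} r≢r′ r′-root with x*y≡0⇒x≡0⊎y≡0 (begin
          (r′ + - r) * evalMonic (quotient cs r) r′
            ≡⟨ sym (+-identityʳ _) ⟩
          (r′ + - r) * evalMonic (quotient cs r) r′ + 0#
            ≡⟨ cong ((r′ + - r) * evalMonic (quotient cs r) r′ +_) (sym r-root) ⟩
          (r′ + - r) * evalMonic (quotient cs r) r′ + evalMonic (c ∷ cs) r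
            ≡⟨ sym (evalMonic-quotient c cs r r′) ⟩
          evalMonic (c ∷ cs) r′
            ≡⟨ r′-root ⟩
          0# ∎)
        where open ≡-Reasoning
      ... | inj₁ r′-r≡0 = ⊥-elim (r≢r′ (sym (x-y≡0⇒x≡y r′-r≡0)))
      ... | inj₂ q-root = q-root

  rootsOfUnity-length≤ : ∀ d {rs} → Unique rs → All (λ r → r ^ suc d ≡ 1#) rs → length rs ≤ suc d
  rootsOfUnity-length≤ d {rs} urs unity =
    subst (length rs ≤_) (cong suc (LP.length-replicate d))
      (roots-length≤degree (- 1# ∷ replicate d 0#) urs (All.map root unity))
    where
      evalMonic-replicate : ∀ k x → evalMonic (replicate k 0#) x ≡ x ^ k
      evalMonic-replicate zero x = refl
      evalMonic-replicate (suc k) x = trans (+-identityˡ _) (cong (x *_) (evalMonic-replicate k x))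
      root : ∀ {r} → r ^ suc d ≡ 1# → - 1# + r * evalMonic (replicate d 0#) r ≡ 0#
      root {r} r^d+1≡1 = trans (cong (λ t → - 1# + r * t) (evalMonic-replicate d r))
                               (trans (cong (- 1# +_) r^d+1≡1) (-‿inverseˡ 1#))

  module Characteristic2 (1+1≡0 : 1# + 1# ≡ 0#) where

    x+x≡0 : ∀ x → x + x ≡ 0#
    x+x≡0 x = begin
        x + x               ≡⟨ solve 1 (λ x → x :+ x := x :* (con 1 :+ con 1)) refl x ⟩
        x * (1# + 1#)       ≡⟨ cong (x *_) 1+1≡0 ⟩
        x * 0#              ≡⟨ zeroʳ x ⟩
        0#                  ∎
      where open ≡-Reasoning

    x+[x+y]≡y : ∀ x y → x + (x + y) ≡ y
    x+[x+y]≡y x y = trans (sym (+-assoc x x y)) (trans (cong (_+ y) (x+x≡0 x)) (+-identityˡ y))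

    x+y≡0⇒x≡y : ∀ {x y} → x + y ≡ 0# → x ≡ y
    x+y≡0⇒x≡y {x} {y} x+y≡0 = trans (sym (x+[x+y]≡y y x)) (trans (cong (y +_) (trans (+-comm y x) x+y≡0)) (+-identityʳ y))

    square-+ : ∀ x y → (x + y) ^ 2 ≡ x ^ 2 + y ^ 2
    square-+ x y = begin
        (x + y) ^ 2
          ≡⟨ solve 2 (λ x y → (x :+ y) :* ((x :+ y) :* con 1)
                              := (x :* (x :* con 1) :+ y :* (y :* con 1)) :+ (x :* y :+ x :* y)) refl x y ⟩
        (x ^ 2 + y ^ 2) + (x * y + x * y)   ≡⟨ cong ((x ^ 2 + y ^ 2) +_) (x+x≡0 (x * y)) ⟩
        (x ^ 2 + y ^ 2) + 0#                ≡⟨ +-identityʳ _ ⟩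
        x ^ 2 + y ^ 2                       ∎
      where open ≡-Reasoning

    ^2^k-homo-+ : ∀ k x y → (x + y) ^ (2 ℕ.^ k) ≡ x ^ (2 ℕ.^ k) + y ^ (2 ℕ.^ k)
    ^2^k-homo-+ zero x y = solve 2 (λ x y → (x :+ y) :* con 1 := x :* con 1 :+ y :* con 1) refl x y
    ^2^k-homo-+ (suc k) x y = begin
        (x + y) ^ (2 ℕ.* 2 ℕ.^ k)                   ≡⟨ sym (^-assocʳ (x + y) 2 (2 ℕ.^ k)) ⟩
        ((x + y) ^ 2) ^ (2 ℕ.^ k)                   ≡⟨ cong (_^ (2 ℕ.^ k)) (square-+ x y) ⟩
        (x ^ 2 + y ^ 2) ^ (2 ℕ.^ k)                 ≡⟨ ^2^k-homo-+ k (x ^ 2) (y ^ 2) ⟩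
        (x ^ 2) ^ (2 ℕ.^ k) + (y ^ 2) ^ (2 ℕ.^ k)   ≡⟨ cong₂ _+_ (^-assocʳ x 2 (2 ℕ.^ k)) (^-assocʳ y 2 (2 ℕ.^ k)) ⟩
        x ^ (2 ℕ.* 2 ℕ.^ k) + y ^ (2 ℕ.* 2 ℕ.^ k)   ∎
      where open ≡-Reasoning

    0^2^k≡0 : ∀ k → 0# ^ (2 ℕ.^ k) ≡ 0#
    0^2^k≡0 zero = zeroˡ 1#
    0^2^k≡0 (suc k) = trans (sym (^-assocʳ 0# 2 (2 ℕ.^ k))) (trans (cong (_^ (2 ℕ.^ k)) (zeroˡ _)) (0^2^k≡0 k))

    square-injective : ∀ {x y} → x * x ≡ y * y → x ≡ y
    square-injective {x} {y} xx≡yy with x*y≡0⇒x≡0⊎y≡0 [x+y]²≡0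
      where
        [x+y]²≡0 : (x + y) * (x + y) ≡ 0#
        [x+y]²≡0 = begin
            (x + y) * (x + y)
              ≡⟨ solve 2 (λ x y → (x :+ y) :* (x :+ y) := (x :* x :+ y :* y) :+ (x :* y :+ x :* y)) refl x y ⟩
            (x * x + y * y) + (x * y + x * y)   ≡⟨ cong₂ _+_ (cong (_+ y * y) xx≡yy) (x+x≡0 (x * y)) ⟩
            (y * y + y * y) + 0#                ≡⟨ cong (_+ 0#) (x+x≡0 (y * y)) ⟩
            0# + 0#                             ≡⟨ +-identityʳ 0# ⟩
            0#                                  ∎
          where open ≡-Reasoning
    ... | inj₁ x+y≡0 = x+y≡0⇒x≡y x+y≡0
    ... | inj₂ x+y≡0 = x+y≡0⇒x≡y x+y≡0

    idempotent⇒≡0⊎≡1 : ∀ {y} → y ^ 2 ≡ y → y ≡ 0# ⊎ y ≡ 1#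
    idempotent⇒≡0⊎≡1 {y} y²≡y with x*y≡0⇒x≡0⊎y≡0 y[y+1]≡0
      where
        y[y+1]≡0 : y * (y + 1#) ≡ 0#
        y[y+1]≡0 = trans (solve 1 (λ y → y :* (y :+ con 1) := y :* (y :* con 1) :+ y) refl y)
                         (trans (cong (_+ y) y²≡y) (x+x≡0 y))
    ... | inj₁ y≡0 = inj₁ y≡0
    ... | inj₂ y+1≡0 = inj₂ (x+y≡0⇒x≡y y+1≡0)

    toBit-0 : toBit 0# ≡ false
    toBit-0 with 0# ≟ 0#
    ... | yes _ = refl
    ... | no 0≢0 = ⊥-elim (0≢0 refl)

    toBit-1 : toBit 1# ≡ true
    toBit-1 with 1# ≟ 0#
    ... | yes 1≡0 = ⊥-elim (0≢1 (sym 1≡0))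
    ... | no _ = refl

    toBit-+ : ∀ {a b} → a ≡ 0# ⊎ a ≡ 1# → b ≡ 0# ⊎ b ≡ 1# → toBit (a + b) ≡ toBit a xor toBit b
    toBit-+ (inj₁ refl) (inj₁ refl) = trans (cong toBit (+-identityʳ 0#)) (trans toBit-0 (sym (cong₂ _xor_ toBit-0 toBit-0)))
    toBit-+ (inj₁ refl) (inj₂ refl) = trans (cong toBit (+-identityˡ 1#)) (trans toBit-1 (sym (cong₂ _xor_ toBit-0 toBit-1)))
    toBit-+ (inj₂ refl) (inj₁ refl) = trans (cong toBit (+-identityʳ 1#)) (trans toBit-1 (sym (cong₂ _xor_ toBit-1 toBit-0)))
    toBit-+ (inj₂ refl) (inj₂ refl) = trans (cong toBit 1+1≡0) (trans toBit-0 (sym (cong₂ _xor_ toBit-1 toBit-1)))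

    -- tr and Tr of the statement are toBit ∘ trace m and toBit ∘ trace (m + m), definitionally.
    trace : ℕ → Carrier → Carrier
    trace k x = sumK (map (λ i → x ^ (2 ℕ.^ i)) (upTo k))

    trace-suc : ∀ k x → trace (suc k) x ≡ x + trace k x ^ 2
    trace-suc k x = cong₂ _+_ (*-identityʳ x) (shift k (λ i → i))
      where
        x^2^ : ℕ → Carrier
        x^2^ i = x ^ (2 ℕ.^ i)
        shift : ∀ k (e : ℕ → ℕ) → sumK (map x^2^ (applyUpTo (λ i → suc (e i)) k)) ≡ sumK (map x^2^ (applyUpTo e k)) ^ 2
        shift zero e = sym (zeroˡ _)
        shift (suc k) e = begin
            x^2^ (suc (e 0)) + sumK (map x^2^ (applyUpTo (λ i → suc (e (suc i))) k))
              ≡⟨ cong₂ _+_ (trans (cong (x ^_) (ℕP.*-comm 2 (2 ℕ.^ e 0))) (sym (^-assocʳ x (2 ℕ.^ e 0) 2)))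
                           (shift k (λ i → e (suc i))) ⟩
            x^2^ (e 0) ^ 2 + sumK (map x^2^ (applyUpTo (λ i → e (suc i)) k)) ^ 2
              ≡⟨ sym (square-+ _ _) ⟩
            (x^2^ (e 0) + sumK (map x^2^ (applyUpTo (λ i → e (suc i)) k))) ^ 2 ∎
          where open ≡-Reasoning

    trace-sucʳ : ∀ k x → trace (suc k) x ≡ trace k x + x ^ (2 ℕ.^ k)
    trace-sucʳ k x = begin
        sumK (map x^2^ (upTo (suc k)))          ≡⟨ cong (λ is → sumK (map x^2^ is)) (sym (LP.upTo-∷ʳ k)) ⟩
        sumK (map x^2^ (upTo k ++ k ∷ []))      ≡⟨ cong sumK (LP.map-++ x^2^ (upTo k) (k ∷ [])) ⟩
        sumK (map x^2^ (upTo k) ++ x^2^ k ∷ [])  ≡⟨ sumK-++ (map x^2^ (upTo k)) (x^2^ k ∷ []) ⟩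
        trace k x + (x^2^ k + 0#)                ≡⟨ cong (trace k x +_) (+-identityʳ _) ⟩
        trace k x + x^2^ k                       ∎
      where
        open ≡-Reasoning
        x^2^ : ℕ → Carrier
        x^2^ i = x ^ (2 ℕ.^ i)

    trace-0 : ∀ k → trace k 0# ≡ 0#
    trace-0 zero = refl
    trace-0 (suc k) = trans (trace-sucʳ k 0#) (trans (cong₂ _+_ (trace-0 k) (0^2^k≡0 k)) (+-identityʳ 0#))

    trace-+ : ∀ k x y → trace k (x + y) ≡ trace k x + trace k y
    trace-+ zero x y = sym (+-identityʳ 0#)
    trace-+ (suc k) x y = begin
        trace (suc k) (x + y)                             ≡⟨ trace-sucʳ k (x + y) ⟩
        trace k (x + y) + (x + y) ^ (2 ℕ.^ k)             ≡⟨ cong₂ _+_ (trace-+ k x y) (^2^k-homo-+ k x y) ⟩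
        (trace k x + trace k y) + (x ^ (2 ℕ.^ k) + y ^ (2 ℕ.^ k))
          ≡⟨ solve 4 (λ a b c d → (a :+ b) :+ (c :+ d) := (a :+ c) :+ (b :+ d)) refl
                     (trace k x) (trace k y) (x ^ (2 ℕ.^ k)) (y ^ (2 ℕ.^ k)) ⟩
        (trace k x + x ^ (2 ℕ.^ k)) + (trace k y + y ^ (2 ℕ.^ k))
          ≡⟨ sym (cong₂ _+_ (trace-sucʳ k x) (trace-sucʳ k y)) ⟩
        trace (suc k) x + trace (suc k) y                 ∎
      where open ≡-Reasoning

    trace-+-length : ∀ k j x → trace (k ℕ.+ j) x ≡ trace j x + trace k (x ^ (2 ℕ.^ j))
    trace-+-length zero j x = sym (+-identityʳ _)
    trace-+-length (suc k) j x = begin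
        trace (suc (k ℕ.+ j)) x                      ≡⟨ trace-sucʳ (k ℕ.+ j) x ⟩
        trace (k ℕ.+ j) x + x ^ (2 ℕ.^ (k ℕ.+ j))    ≡⟨ cong₂ _+_ (trace-+-length k j x) x^2^[k+j] ⟩
        (trace j x + trace k y) + y ^ (2 ℕ.^ k)      ≡⟨ +-assoc _ _ _ ⟩
        trace j x + (trace k y + y ^ (2 ℕ.^ k))      ≡⟨ cong (trace j x +_) (sym (trace-sucʳ k y)) ⟩
        trace j x + trace (suc k) y                  ∎
      where
        open ≡-Reasoning
        y : Carrier
        y = x ^ (2 ℕ.^ j)
        x^2^[k+j] : x ^ (2 ℕ.^ (k ℕ.+ j)) ≡ y ^ (2 ℕ.^ k)
        x^2^[k+j] = trans (cong (x ^_) (trans (ℕP.^-distribˡ-+-* 2 k j) (ℕP.*-comm (2 ℕ.^ k) (2 ℕ.^ j))))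
                          (sym (^-assocʳ x (2 ℕ.^ j) (2 ℕ.^ k)))

    trace-idempotent : ∀ k {x} → x ^ (2 ℕ.^ k) ≡ x → trace k x ^ 2 ≡ trace k x
    trace-idempotent k {x} x^2^k≡x = begin
        t ^ 2                      ≡⟨ sym (x+[x+y]≡y x (t ^ 2)) ⟩
        x + (x + t ^ 2)            ≡⟨ cong (x +_) (sym (trace-suc k x)) ⟩
        x + trace (suc k) x        ≡⟨ cong (x +_) (trace-sucʳ k x) ⟩
        x + (t + x ^ (2 ℕ.^ k))    ≡⟨ cong (λ z → x + (t + z)) x^2^k≡x ⟩
        x + (t + x)                ≡⟨ solve 2 (λ x t → x :+ (t :+ x) := x :+ (x :+ t)) refl x t ⟩
        x + (x + t)                ≡⟨ x+[x+y]≡y x t ⟩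
        t                          ∎
      where
        open ≡-Reasoning
        t : Carrier
        t = trace k x

module NihoBentDual (m′ : ℕ) (K : FiniteField (2 ℕ.^ suc m′ ℕ.* 2 ℕ.^ suc m′)) where
  open Ops K
  open WithQ (suc m′)
  open FiniteFieldProperties K
  open Characteristic2 (1+1≡0 (2 ℕ.^ m′ ℕ.* q) (ℕP.*-assoc 2 (2 ℕ.^ m′) q))
  open IsCommutativeRing isCommutativeRing
    using (+-comm; +-identityʳ; *-comm; *-identityˡ; *-identityʳ; zeroˡ; zeroʳ; distribˡ)
  open import Algebra.Solver.Ring.NaturalCoefficients.Default (CommutativeRing.commutativeSemiring commutativeRing)
    using (solve; _:=_; _:*_)
  open IntegerSums

  p : ℕ
  p = q ℕ.∸ 2

  q≡2+p : q ≡ 2 ℕ.+ p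
  q≡2+p = sym (ℕP.m+[n∸m]≡n (ℕP.*-monoʳ-≤ 2 (ℕP.m^n>0 2 m′)))

  conj-+ : ∀ x y → conj (x + y) ≡ conj x + conj y
  conj-+ = ^2^k-homo-+ (suc m′)

  conj-* : ∀ x y → conj (x * y) ≡ conj x * conj y
  conj-* x y = ^-distrib-* x y q

  conj-involutive : ∀ x → conj (conj x) ≡ x
  conj-involutive x = trans (^-assocʳ x q q) (^-card x)

  InF-0 : InF 0#
  InF-0 = 0^2^k≡0 (suc m′)

  InF-+ : ∀ {a b} → InF a → InF b → InF (a + b)
  InF-+ {a} {b} a∈F b∈F = trans (conj-+ a b) (cong₂ _+_ a∈F b∈F)

  InF-* : ∀ {a b} → InF a → InF b → InF (a * b)
  InF-* {a} {b} a∈F b∈F = trans (conj-* a b) (cong₂ _*_ a∈F b∈F)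

  InF-inverse : ∀ {l l′} → InF l → l * l′ ≡ 1# → InF l′
  InF-inverse {l} {l′} l∈F ll′≡1 = *-cancelˡ (x*y≡1⇒x≢0 ll′≡1) (begin
      l * conj l′        ≡⟨ cong (_* conj l′) (sym l∈F) ⟩
      conj l * conj l′   ≡⟨ sym (conj-* l l′) ⟩
      conj (l * l′)      ≡⟨ cong conj ll′≡1 ⟩
      conj 1#            ≡⟨ ^-zeroˡ q ⟩
      1#                 ≡⟨ sym ll′≡1 ⟩
      l * l′             ∎)
    where open ≡-Reasoning

  InF-^[q∸1] : ∀ {y} → InF y → y ≢ 0# → y ^ (q ℕ.∸ 1) ≡ 1#
  InF-^[q∸1] {y} y∈F y≢0 = *-cancelˡ y≢0 (begin
      y * y ^ (q ℕ.∸ 1)   ≡⟨ cong (λ k → y * y ^ (k ℕ.∸ 1)) q≡2+p ⟩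
      y ^ (2 ℕ.+ p)       ≡⟨ cong (y ^_) (sym q≡2+p) ⟩
      y ^ q               ≡⟨ y∈F ⟩
      y                   ≡⟨ sym (*-identityʳ y) ⟩
      y * 1#              ∎)
    where open ≡-Reasoning

  T∈F : ∀ y → InF (T y)
  T∈F y = trans (conj-+ y (conj y)) (trans (cong (conj y +_) (conj-involutive y)) (+-comm _ _))

  T-*ˡ : ∀ {l} y → InF l → T (l * y) ≡ l * T y
  T-*ˡ {l} y l∈F = begin
      l * y + conj (l * y)      ≡⟨ cong (l * y +_) (trans (conj-* l y) (cong (_* conj y) l∈F)) ⟩
      l * y + l * conj y        ≡⟨ sym (distribˡ l y (conj y)) ⟩
      l * (y + conj y)          ∎
    where open ≡-Reasoning

  InS-1 : InS 1#
  InS-1 = trans (*-identityˡ _) (^-zeroˡ q)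

  norm : Carrier → Carrier
  norm z = z * conj z

  norm∈F : ∀ z → InF (norm z)
  norm∈F z = trans (conj-* z (conj z)) (trans (cong (conj z *_) (conj-involutive z)) (*-comm _ _))

  norm-polar : ∀ {l u} → InF l → InS u → norm (l * u) ≡ l * l
  norm-polar {l} {u} l∈F u∈S = begin
      (l * u) * conj (l * u)        ≡⟨ cong ((l * u) *_) (trans (conj-* l u) (cong (_* conj u) l∈F)) ⟩
      (l * u) * (l * conj u)        ≡⟨ solve 3 (λ l u ū → (l :* u) :* (l :* ū) := (l :* l) :* (u :* ū)) refl l u (conj u) ⟩
      (l * l) * (u * conj u)        ≡⟨ cong ((l * l) *_) u∈S ⟩
      (l * l) * 1#                  ≡⟨ *-identityʳ _ ⟩
      l * l                         ∎
    where open ≡-Reasoning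

  -- The radius of z is √(z z̄) = (z z̄)^(q/2), which lies in F because z z̄ does.
  polar : ∀ {z} → z ≢ 0# → ∃₂ λ l u → InF l × l ≢ 0# × InS u × l * u ≡ z
  polar {z} z≢0 = l , z * l⁻¹ , l∈F , l≢0 , u∈S , lu≡z
    where
      open ≡-Reasoning
      l : Carrier
      l = norm z ^ (2 ℕ.^ m′)
      l≢0 : l ≢ 0#
      l≢0 = ^-≢0 (2 ℕ.^ m′) (*-≢0 z≢0 (^-≢0 q z≢0))
      l⁻¹ : Carrier
      l⁻¹ = proj₁ (inverse l l≢0)
      ll⁻¹≡1 : l * l⁻¹ ≡ 1#
      ll⁻¹≡1 = proj₂ (inverse l l≢0)
      ll≡norm : l * l ≡ norm z
      ll≡norm = begin
          l * l                     ≡⟨ cong (l *_) (sym (*-identityʳ l)) ⟩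
          l ^ 2                     ≡⟨ ^-assocʳ (norm z) (2 ℕ.^ m′) 2 ⟩
          norm z ^ (2 ℕ.^ m′ ℕ.* 2) ≡⟨ cong (norm z ^_) (ℕP.*-comm (2 ℕ.^ m′) 2) ⟩
          norm z ^ q                ≡⟨ norm∈F z ⟩
          norm z                    ∎
      l∈F : InF l
      l∈F = begin
          l ^ q                     ≡⟨ ^-assocʳ (norm z) (2 ℕ.^ m′) q ⟩
          norm z ^ (2 ℕ.^ m′ ℕ.* q) ≡⟨ cong (norm z ^_) (ℕP.*-comm (2 ℕ.^ m′) q) ⟩
          norm z ^ (q ℕ.* 2 ℕ.^ m′) ≡⟨ sym (^-assocʳ (norm z) q (2 ℕ.^ m′)) ⟩
          (norm z ^ q) ^ (2 ℕ.^ m′) ≡⟨ cong (_^ (2 ℕ.^ m′)) (norm∈F z) ⟩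
          l                         ∎
      u∈S : InS (z * l⁻¹)
      u∈S = begin
          (z * l⁻¹) * conj (z * l⁻¹)       ≡⟨ cong ((z * l⁻¹) *_) (conj-* z l⁻¹) ⟩
          (z * l⁻¹) * (conj z * conj l⁻¹)  ≡⟨ cong (λ t → (z * l⁻¹) * (conj z * t)) (InF-inverse l∈F ll⁻¹≡1) ⟩
          (z * l⁻¹) * (conj z * l⁻¹)
            ≡⟨ solve 3 (λ z z̄ i → (z :* i) :* (z̄ :* i) := (z :* z̄) :* (i :* i)) refl z (conj z) l⁻¹ ⟩
          norm z * (l⁻¹ * l⁻¹)             ≡⟨ cong (_* (l⁻¹ * l⁻¹)) (sym ll≡norm) ⟩
          (l * l) * (l⁻¹ * l⁻¹)            ≡⟨ solve 2 (λ l i → (l :* l) :* (i :* i) := (l :* i) :* (l :* i)) refl l l⁻¹ ⟩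
          (l * l⁻¹) * (l * l⁻¹)            ≡⟨ cong₂ _*_ ll⁻¹≡1 ll⁻¹≡1 ⟩
          1# * 1#                          ≡⟨ *-identityʳ 1# ⟩
          1#                               ∎
      lu≡z : l * (z * l⁻¹) ≡ z
      lu≡z = trans (solve 3 (λ l z i → l :* (z :* i) := z :* (l :* i)) refl l z l⁻¹)
                   (trans (cong (z *_) ll⁻¹≡1) (*-identityʳ z))

  polar-injective : ∀ {l u l′ u′} → InF l → InS u → InF l′ → InS u′ → l ≢ 0# →
                    l * u ≡ l′ * u′ → l ≡ l′ × u ≡ u′
  polar-injective {l} {u} {l′} {u′} l∈F u∈S l′∈F u′∈S l≢0 lu≡l′u′ =
    l≡l′ , *-cancelˡ l≢0 (trans lu≡l′u′ (cong (_* u′) (sym l≡l′)))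
    where
      l≡l′ : l ≡ l′
      l≡l′ = square-injective (trans (sym (norm-polar l∈F u∈S)) (trans (cong norm lu≡l′u′) (norm-polar l′∈F u′∈S)))

  InF? : Decidable InF
  InF? x = (x ^ q) ≟ x

  InS? : Decidable InS
  InS? u = (u * conj u) ≟ 1#

  F-elements : List Carrier
  F-elements = filter InF? elements

  F*-elements : List Carrier
  F*-elements = filter nonzero? F-elements

  ∈-F⁺ : ∀ {x} → InF x → x ∈ F-elements
  ∈-F⁺ {x} = ∈-filter⁺ InF? (∈-elements x)

  ∈-F⁻ : ∀ {x} → x ∈ F-elements → InF x
  ∈-F⁻ x∈ = proj₂ (∈-filter⁻ InF? {xs = elements} x∈)

  ∈-F*⁺ : ∀ {x} → InF x → x ≢ 0# → x ∈ F*-elements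
  ∈-F*⁺ x∈F = ∈-filter⁺ nonzero? (∈-F⁺ x∈F)

  ∈-F*⁻ : ∀ {x} → x ∈ F*-elements → InF x × x ≢ 0#
  ∈-F*⁻ x∈ with ∈-filter⁻ nonzero? {xs = F-elements} x∈
  ... | x∈F , x≢0 = ∈-F⁻ x∈F , x≢0

  ∈-S⁺ : ∀ {u} → InS u → u ∈ S-elements
  ∈-S⁺ {u} = ∈-filter⁺ InS? (∈-elements u)

  ∈-S⁻ : ∀ {u} → u ∈ S-elements → InS u
  ∈-S⁻ u∈ = proj₂ (∈-filter⁻ InS? {xs = elements} u∈)

  F-unique : Unique F-elements
  F-unique = UniqueP.filter⁺ InF? elements-unique

  F*-unique : Unique F*-elements
  F*-unique = UniqueP.filter⁺ nonzero? F-unique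

  S-unique : Unique S-elements
  S-unique = UniqueP.filter⁺ InS? elements-unique

  F↭0∷F* : F-elements ↭ 0# ∷ F*-elements
  F↭0∷F* = ↭-∷-filter-≢ _≟_ F-unique (∈-F⁺ InF-0)

  polarProduct : Carrier × Carrier → Carrier
  polarProduct (u , l) = l * u

  polar-elements : List Carrier
  polar-elements = map polarProduct (cartesianProduct S-elements F*-elements)

  ∈-polar⁺ : ∀ {l u} → InF l → l ≢ 0# → InS u → l * u ∈ polar-elements
  ∈-polar⁺ l∈F l≢0 u∈S = ∈-map⁺ polarProduct (∈-cartesianProduct⁺ (∈-S⁺ u∈S) (∈-F*⁺ l∈F l≢0))

  ∈-polar⁻ : ∀ {z} → z ∈ polar-elements → ∃₂ λ l u → (InF l × l ≢ 0#) × InS u × z ≡ l * u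
  ∈-polar⁻ z∈ with ∈-map⁻ polarProduct z∈
  ... | (u , l) , ul∈ , z≡lu with ∈-cartesianProduct⁻ S-elements F*-elements ul∈
  ...   | u∈ , l∈ = l , u , ∈-F*⁻ l∈ , ∈-S⁻ u∈ , z≡lu

  polar-unique : Unique polar-elements
  polar-unique = unique-map⁺-local injective (UniqueP.cartesianProduct⁺ S-unique F*-unique)
    where
      injective : ∀ {x y} → x ∈ cartesianProduct S-elements F*-elements → y ∈ cartesianProduct S-elements F*-elements →
                  polarProduct x ≡ polarProduct y → x ≡ y
      injective {u , l} {u′ , l′} ul∈ ul′∈ lu≡l′u′ =
        let u∈ , l∈ = ∈-cartesianProduct⁻ S-elements F*-elements ul∈
            u′∈ , l′∈ = ∈-cartesianProduct⁻ S-elements F*-elements ul′∈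
            l∈F , l≢0 = ∈-F*⁻ l∈
            l≡l′ , u≡u′ = polar-injective l∈F (∈-S⁻ u∈) (proj₁ (∈-F*⁻ l′∈)) (∈-S⁻ u′∈) l≢0 lu≡l′u′
        in cong₂ _,_ u≡u′ l≡l′

  elements↭0∷polar : elements ↭ 0# ∷ polar-elements
  elements↭0∷polar =
    unique∧set⇒↭ elements-unique (0∉polar ∷ polar-unique) (λ {z} _ → decompose z) (λ {z} _ → ∈-elements z)
    where
      0∉polar : All (0# ≢_) polar-elements
      0∉polar = All.tabulate λ z∈ 0≡z →
        let l , u , (_ , l≢0) , u∈S , z≡lu = ∈-polar⁻ z∈ in
        *-≢0 l≢0 (x*y≡1⇒x≢0 u∈S) (trans (sym z≡lu) (sym 0≡z))
      decompose : ∀ z → z ∈ 0# ∷ polar-elements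
      decompose z with z ≟ 0#
      ... | yes z≡0 = here z≡0
      ... | no z≢0 = let l , u , l∈F , l≢0 , u∈S , lu≡z = polar z≢0 in
        there (subst (_∈ polar-elements) lu≡z (∈-polar⁺ l∈F l≢0 u∈S))

  |S|*|F*|≡[1+q]*[1+p] : length S-elements ℕ.* length F*-elements ≡ suc q ℕ.* suc p
  |S|*|F*|≡[1+q]*[1+p] = ℕP.suc-injective (begin
      suc (length S-elements ℕ.* length F*-elements)
        ≡⟨ cong suc (sym (trans (LP.length-map polarProduct (cartesianProduct S-elements F*-elements))
                                (length-cartesianProduct S-elements F*-elements))) ⟩
      suc (length polar-elements)   ≡⟨ sym (PermP.↭-length elements↭0∷polar) ⟩
      length elements               ≡⟨ length-elements ⟩
      q ℕ.* q                       ≡⟨ cong (λ k → k ℕ.* k) q≡2+p ⟩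
      (2 ℕ.+ p) ℕ.* (2 ℕ.+ p)       ≡⟨ square p ⟩
      suc ((3 ℕ.+ p) ℕ.* (1 ℕ.+ p)) ≡⟨ cong (λ k → suc (suc k ℕ.* suc p)) (sym q≡2+p) ⟩
      suc (suc q ℕ.* suc p)         ∎)
    where
      open ≡-Reasoning
      square : ∀ p → (2 ℕ.+ p) ℕ.* (2 ℕ.+ p) ≡ suc ((3 ℕ.+ p) ℕ.* (1 ℕ.+ p))
      square = ℕSolver.solve-∀

  |S|≡1+q×|F*|≡1+p : length S-elements ≡ suc q × length F*-elements ≡ suc p
  |S|≡1+q×|F*|≡1+p = *-≡-bounded⇒≡ q p
    (rootsOfUnity-length≤ q S-unique (All.tabulate ∈-S⁻))
    (rootsOfUnity-length≤ p F*-unique (All.tabulate λ {y} y∈ → let y∈F , y≢0 = ∈-F*⁻ y∈ in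
      trans (cong (λ k → y ^ (k ℕ.∸ 1)) (sym q≡2+p)) (InF-^[q∸1] y∈F y≢0)))
    |S|*|F*|≡[1+q]*[1+p]

  tr-+ : ∀ {a b} → InF a → InF b → tr (a + b) ≡ tr a xor tr b
  tr-+ {a} {b} a∈F b∈F = trans (cong toBit (trace-+ (suc m′) a b)) (toBit-+ (bit a∈F) (bit b∈F))
    where
      bit : ∀ {x} → InF x → trace (suc m′) x ≡ 0# ⊎ trace (suc m′) x ≡ 1#
      bit x∈F = idempotent⇒≡0⊎≡1 (trace-idempotent (suc m′) x∈F)

  Tr≡tr∘T : ∀ y → Tr y ≡ tr (T y)
  Tr≡tr∘T y = cong toBit (trans (trace-+-length (suc m′) (suc m′) y) (sym (trace-+ (suc m′) y (conj y))))

  tr-0 : tr 0# ≡ false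
  tr-0 = trans (cong toBit (trace-0 (suc m′))) toBit-0

  Tr-0 : Tr 0# ≡ false
  Tr-0 = trans (Tr≡tr∘T 0#) (trans (cong tr (trans (cong (0# +_) InF-0) (+-identityʳ 0#))) tr-0)

  qIfZero : Carrier → ℕ
  qIfZero c = if does (c ≟ 0#) then q else 0

  sign-not : ∀ b → sign (not b) ≡ ℤ.- sign b
  sign-not false = refl
  sign-not true = refl

  module CharacterSums {μ₀ : Carrier} (μ₀∈F : InF μ₀) (tr-μ₀ : tr μ₀ ≡ true) where

    sum-sign-tr-F : sumℤ (map (sign ∘ tr) F-elements) ≡ ℤ.+ 0
    sum-sign-tr-F = i≡-i⇒i≡0 (begin
        sumℤ (map (sign ∘ tr) F-elements)                ≡⟨ sym (sumℤ-↭ (PermP.map⁺ (sign ∘ tr) translation-permutes)) ⟩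
        sumℤ (map (sign ∘ tr) (map (μ₀ +_) F-elements))  ≡⟨ cong sumℤ (sym (LP.map-∘ F-elements)) ⟩
        sumℤ (map (λ μ → sign (tr (μ₀ + μ))) F-elements) ≡⟨ cong sumℤ (LP.map-cong-local (All.tabulate flip-sign)) ⟩
        sumℤ (map (λ μ → ℤ.- sign (tr μ)) F-elements)    ≡⟨ sumℤ-map-neg (sign ∘ tr) F-elements ⟩
        ℤ.- sumℤ (map (sign ∘ tr) F-elements)            ∎)
      where
        open ≡-Reasoning
        translation-permutes : map (μ₀ +_) F-elements ↭ F-elements
        translation-permutes = map-inverse-↭ (μ₀ +_) (μ₀ +_) (x+[x+y]≡y μ₀) (x+[x+y]≡y μ₀) F-unique
          (λ μ∈ → ∈-F⁺ (InF-+ μ₀∈F (∈-F⁻ μ∈))) (λ μ∈ → ∈-F⁺ (InF-+ μ₀∈F (∈-F⁻ μ∈)))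
        flip-sign : ∀ {μ} → μ ∈ F-elements → sign (tr (μ₀ + μ)) ≡ ℤ.- sign (tr μ)
        flip-sign {μ} μ∈ = trans (cong sign (trans (tr-+ μ₀∈F (∈-F⁻ μ∈)) (cong (_xor tr μ) tr-μ₀))) (sign-not (tr μ))

    sum-sign-tr-F* : sumℤ (map (sign ∘ tr) F*-elements) ≡ ℤ.- ℤ.+ 1
    sum-sign-tr-F* = begin
        B                           ≡⟨ regroup B ⟩
        (ℤ.+ 1 ℤ.+ B) ℤ.- ℤ.+ 1     ≡⟨ cong (λ t → (sign t ℤ.+ B) ℤ.- ℤ.+ 1) (sym tr-0) ⟩
        sumℤ (map (sign ∘ tr) (0# ∷ F*-elements)) ℤ.- ℤ.+ 1
          ≡⟨ cong (ℤ._- ℤ.+ 1) (sym (sumℤ-↭ (PermP.map⁺ (sign ∘ tr) F↭0∷F*))) ⟩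
        sumℤ (map (sign ∘ tr) F-elements) ℤ.- ℤ.+ 1
          ≡⟨ cong (ℤ._- ℤ.+ 1) sum-sign-tr-F ⟩
        ℤ.- ℤ.+ 1                   ∎
      where
        open ≡-Reasoning
        B : ℤ
        B = sumℤ (map (sign ∘ tr) F*-elements)
        regroup : ∀ b → b ≡ (ℤ.+ 1 ℤ.+ b) ℤ.- ℤ.+ 1
        regroup = solve-∀

    sum-sign-tr-scaled : ∀ {c} → InF c → sumℤ (map (λ l → sign (tr (l * c))) F*-elements) ≡ ℤ.+ qIfZero c ℤ.- ℤ.+ 1
    sum-sign-tr-scaled {c} c∈F with c ≟ 0#
    ... | yes c≡0 = begin
        sumℤ (map (λ l → sign (tr (l * c))) F*-elements) ≡⟨ cong sumℤ (LP.map-cong sign-tr[l*c]≡1 F*-elements) ⟩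
        sumℤ (map (λ _ → ℤ.+ 1) F*-elements)             ≡⟨ sumℤ-map-1 F*-elements ⟩
        ℤ.+ length F*-elements                            ≡⟨ cong ℤ.+_ (proj₂ |S|≡1+q×|F*|≡1+p) ⟩
        ℤ.+ (2 ℕ.+ p) ℤ.- ℤ.+ 1                           ≡⟨ cong (λ k → ℤ.+ k ℤ.- ℤ.+ 1) (sym q≡2+p) ⟩
        ℤ.+ q ℤ.- ℤ.+ 1                                   ∎
      where
        open ≡-Reasoning
        sign-tr[l*c]≡1 : ∀ l → sign (tr (l * c)) ≡ ℤ.+ 1
        sign-tr[l*c]≡1 l = cong sign (trans (cong (λ t → tr (l * t)) c≡0) (trans (cong tr (zeroʳ l)) tr-0))
    ... | no c≢0 with inverse c c≢0
    ...   | c⁻¹ , cc⁻¹≡1 = begin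
        sumℤ (map (λ l → sign (tr (l * c))) F*-elements)
          ≡⟨ cong sumℤ (LP.map-cong (λ l → cong (sign ∘ tr) (*-comm l c)) F*-elements) ⟩
        sumℤ (map (λ l → sign (tr (c * l))) F*-elements)
          ≡⟨ cong sumℤ (LP.map-∘ F*-elements) ⟩
        sumℤ (map (sign ∘ tr) (map (c *_) F*-elements))
          ≡⟨ sumℤ-↭ (PermP.map⁺ (sign ∘ tr) scaling-permutes) ⟩
        sumℤ (map (sign ∘ tr) F*-elements)
          ≡⟨ sum-sign-tr-F* ⟩
        ℤ.- ℤ.+ 1 ∎
      where
        open ≡-Reasoning
        c⁻¹∈F : InF c⁻¹
        c⁻¹∈F = InF-inverse c∈F cc⁻¹≡1
        c⁻¹≢0 : c⁻¹ ≢ 0#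
        c⁻¹≢0 = x*y≡1⇒x≢0 (trans (*-comm c⁻¹ c) cc⁻¹≡1)
        scaled : ∀ {a} → InF a → a ≢ 0# → ∀ {y} → y ∈ F*-elements → a * y ∈ F*-elements
        scaled a∈F a≢0 y∈ = let y∈F , y≢0 = ∈-F*⁻ y∈ in ∈-F*⁺ (InF-* a∈F y∈F) (*-≢0 a≢0 y≢0)
        scaling-permutes : map (c *_) F*-elements ↭ F*-elements
        scaling-permutes = scaling-↭ cc⁻¹≡1 F*-unique (scaled c∈F c≢0) (scaled c⁻¹∈F c⁻¹≢0)

  qIfZero-≡0 : ∀ {c} → c ≡ 0# → qIfZero c ≡ q
  qIfZero-≡0 {c} c≡0 with c ≟ 0#
  ... | yes _ = refl
  ... | no c≢0 = ⊥-elim (c≢0 c≡0)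

  qIfZero-≢0 : ∀ {c} → c ≢ 0# → qIfZero c ≡ 0
  qIfZero-≢0 {c} c≢0 with c ≟ 0#
  ... | yes c≡0 = ⊥-elim (c≢0 c≡0)
  ... | no _ = refl

  0^[q∸1] : 0# ^ (q ℕ.∸ 1) ≡ 0#
  0^[q∸1] = trans (cong (λ k → 0# ^ (k ℕ.∸ 1)) q≡2+p) (zeroˡ _)

  module WalshSpectrum (f : Carrier → Bool) (g : Carrier → Carrier)
                       (g∈F : ∀ u → InS u → InF (g u))
                       (f-polar : ∀ l u → InF l → InS u → f (l * u) ≡ tr (l * g u)) where

    coeff : Carrier → Carrier → Carrier
    coeff x u = T (x * u) + g u

    coeff∈F : ∀ x {u} → InS u → InF (coeff x u)
    coeff∈F x {u} u∈S = InF-+ (T∈F (x * u)) (g∈F u u∈S)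

    f-0 : f 0# ≡ false
    f-0 = trans (cong f (sym (zeroˡ 1#))) (trans (f-polar 0# 1# InF-0 InS-1) (trans (cong tr (zeroˡ (g 1#))) tr-0))

    -- If tr vanished on F then so would f, making W_f(0) = q² rather than ±q.
    tr-nontrivial : IsBent f → ∃ λ μ → InF μ × tr μ ≡ true
    tr-nontrivial bent with any? (λ μ → tr μ Bool.≟ true) F-elements
    ... | yes found = let μ , μ∈ , tr-μ = find found in μ , ∈-F⁻ μ∈ , tr-μ
    ... | no none = ⊥-elim (q²≢±q (bent 0#))
      where
        f≡false : ∀ z → f z ≡ false
        f≡false z with z ≟ 0#
        ... | yes z≡0 = trans (cong f z≡0) f-0
        ... | no z≢0 = let l , u , l∈F , _ , u∈S , lu≡z = polar z≢0 in
          trans (cong f (sym lu≡z)) (trans (f-polar l u l∈F u∈S)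
            (BoolP.¬-not (λ tr≡true → none (lose (∈-F⁺ (InF-* l∈F (g∈F u u∈S))) tr≡true))))
        W-0≡q² : W f 0# ≡ ℤ.+ (q ℕ.* q)
        W-0≡q² = begin
            sumℤ (map (λ z → sign (f z xor Tr (0# * z))) elements)
              ≡⟨ cong sumℤ (LP.map-cong (λ z → cong₂ (λ a b → sign (a xor b)) (f≡false z)
                                                                   (trans (cong Tr (zeroˡ z)) Tr-0)) elements) ⟩
            sumℤ (map (λ _ → ℤ.+ 1) elements)   ≡⟨ sumℤ-map-1 elements ⟩
            ℤ.+ length elements                  ≡⟨ cong ℤ.+_ length-elements ⟩
            ℤ.+ (q ℕ.* q)                        ∎
          where open ≡-Reasoning
        q²≢±q : ¬ (W f 0# ≡ ℤ.+ q ⊎ W f 0# ≡ ℤ.- ℤ.+ q)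
        q²≢±q (inj₁ W≡q) with subst (λ k → k ℕ.* k ≡ k) q≡2+p (ℤP.+-injective (trans (sym W-0≡q²) W≡q))
        ... | q²≡q with ℕP.*-cancelʳ-≡ (2 ℕ.+ p) 1 (2 ℕ.+ p) (trans q²≡q (sym (ℕP.*-identityˡ _)))
        ...   | ()
        q²≢±q (inj₂ W≡-q) with subst (λ k → ℤ.+ (k ℕ.* k) ≡ ℤ.- ℤ.+ k) q≡2+p (trans (sym W-0≡q²) W≡-q)
        ... | ()

    term-polar : ∀ x {l u} → InF l → InS u → sign (f (l * u) xor Tr (x * (l * u))) ≡ sign (tr (l * coeff x u))
    term-polar x {l} {u} l∈F u∈S = cong sign (begin
        f (l * u) xor Tr (x * (l * u))          ≡⟨ cong₂ _xor_ (f-polar l u l∈F u∈S) (Tr≡tr∘T (x * (l * u))) ⟩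
        tr (l * g u) xor tr (T (x * (l * u)))
          ≡⟨ cong (λ t → tr (l * g u) xor tr (T t)) (solve 3 (λ x l u → x :* (l :* u) := l :* (x :* u)) refl x l u) ⟩
        tr (l * g u) xor tr (T (l * (x * u)))   ≡⟨ cong (λ t → tr (l * g u) xor tr t) (T-*ˡ (x * u) l∈F) ⟩
        tr (l * g u) xor tr (l * T (x * u))     ≡⟨ sym (tr-+ (InF-* l∈F (g∈F u u∈S)) (InF-* l∈F (T∈F (x * u)))) ⟩
        tr (l * g u + l * T (x * u))            ≡⟨ cong tr (trans (+-comm _ _) (sym (distribˡ l (T (x * u)) (g u)))) ⟩
        tr (l * coeff x u)                      ∎)
      where open ≡-Reasoning

    q·#zeros : Carrier → ℕ
    q·#zeros x = sum (map (λ u → qIfZero (coeff x u)) S-elements)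

    -- K is 0 together with the disjoint lines F*u, u ∈ S.
    walsh : (∃ λ μ → InF μ × tr μ ≡ true) → ∀ x → W f x ≡ ℤ.+ q·#zeros x ℤ.- ℤ.+ q
    walsh (μ₀ , μ₀∈F , tr-μ₀) x = begin
        sumℤ (map term elements)
          ≡⟨ sumℤ-↭ (PermP.map⁺ term elements↭0∷polar) ⟩
        term 0# ℤ.+ sumℤ (map term polar-elements)
          ≡⟨ cong₂ ℤ._+_ term-0 (cong sumℤ (sym (LP.map-∘ (cartesianProduct S-elements F*-elements)))) ⟩
        ℤ.+ 1 ℤ.+ sumℤ (map (term ∘ polarProduct) (cartesianProduct S-elements F*-elements))
          ≡⟨ cong (ℤ._+_ (ℤ.+ 1)) (sumℤ-cartesianProduct (term ∘ polarProduct) S-elements F*-elements) ⟩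
        ℤ.+ 1 ℤ.+ sumℤ (map (λ u → sumℤ (map (λ l → term (l * u)) F*-elements)) S-elements)
          ≡⟨ cong (ℤ._+_ (ℤ.+ 1)) (cong sumℤ (LP.map-cong-local (All.tabulate line-sum))) ⟩
        ℤ.+ 1 ℤ.+ sumℤ (map (λ u → ℤ.+ qIfZero (coeff x u) ℤ.- ℤ.+ 1) S-elements)
          ≡⟨ cong (ℤ._+_ (ℤ.+ 1)) (sumℤ-map-pred (λ u → qIfZero (coeff x u)) S-elements) ⟩
        ℤ.+ 1 ℤ.+ (ℤ.+ q·#zeros x ℤ.- ℤ.+ length S-elements)
          ≡⟨ cong (λ k → ℤ.+ 1 ℤ.+ (ℤ.+ q·#zeros x ℤ.- ℤ.+ k)) (proj₁ |S|≡1+q×|F*|≡1+p) ⟩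
        ℤ.+ 1 ℤ.+ (ℤ.+ q·#zeros x ℤ.- ℤ.+ suc q)
          ≡⟨ cong (λ t → ℤ.+ 1 ℤ.+ (ℤ.+ q·#zeros x ℤ.- t)) (ℤP.pos-+ 1 q) ⟩
        ℤ.+ 1 ℤ.+ (ℤ.+ q·#zeros x ℤ.- (ℤ.+ 1 ℤ.+ ℤ.+ q))
          ≡⟨ regroup (ℤ.+ q·#zeros x) (ℤ.+ q) ⟩
        ℤ.+ q·#zeros x ℤ.- ℤ.+ q ∎
      where
        open ≡-Reasoning
        open CharacterSums μ₀∈F tr-μ₀
        term : Carrier → ℤ
        term z = sign (f z xor Tr (x * z))
        term-0 : term 0# ≡ ℤ.+ 1
        term-0 = cong₂ (λ a b → sign (a xor b)) f-0 (trans (cong Tr (zeroʳ x)) Tr-0)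
        line-sum : ∀ {u} → u ∈ S-elements →
                   sumℤ (map (λ l → term (l * u)) F*-elements) ≡ ℤ.+ qIfZero (coeff x u) ℤ.- ℤ.+ 1
        line-sum u∈ = trans (cong sumℤ (LP.map-cong-local
                              (All.tabulate λ l∈ → term-polar x (proj₁ (∈-F*⁻ l∈)) (∈-S⁻ u∈))))
                            (sum-sign-tr-scaled (coeff∈F x (∈-S⁻ u∈)))
        regroup : ∀ a b → ℤ.+ 1 ℤ.+ (a ℤ.- (ℤ.+ 1 ℤ.+ b)) ≡ a ℤ.- b
        regroup = solve-∀

    q≤q·#zeros : ∀ x {u} → u ∈ S-elements → coeff x u ≡ 0# → q ≤ q·#zeros x
    q≤q·#zeros x u∈ c≡0 =
      ∈⇒≤sum (subst (_∈ map (λ u → qIfZero (coeff x u)) S-elements) (qIfZero-≡0 c≡0) (∈-map⁺ _ u∈))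

    walsh-≡q : IsBent f → ∀ x {u} → u ∈ S-elements → coeff x u ≡ 0# → W f x ≡ ℤ.+ q
    walsh-≡q bent x u∈ c≡0 with bent x
    ... | inj₁ W≡q = W≡q
    ... | inj₂ W≡-q = contradiction (subst (ℕ._≤ 0) q≡2+p (subst (q ≤_) q·#zeros≡0 (q≤q·#zeros x u∈ c≡0))) (λ ())
      where
        q·#zeros≡0 : q·#zeros x ≡ 0
        q·#zeros≡0 = ℤP.+-injective (i-j≡-j⇒i≡0 (trans (sym (walsh (tr-nontrivial bent) x)) W≡-q))

    walsh-≡-q : IsBent f → ∀ x → All (λ u → coeff x u ≢ 0#) S-elements → W f x ≡ ℤ.- ℤ.+ q
    walsh-≡-q bent x nonzero = begin
        W f x                            ≡⟨ walsh (tr-nontrivial bent) x ⟩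
        ℤ.+ q·#zeros x ℤ.- ℤ.+ q         ≡⟨ cong (λ k → ℤ.+ k ℤ.- ℤ.+ q) (sum-map-≡0 (All.map qIfZero-≢0 nonzero)) ⟩
        ℤ.+ 0 ℤ.- ℤ.+ q                  ≡⟨ ℤP.+-identityˡ _ ⟩
        ℤ.- ℤ.+ q                        ∎
      where open ≡-Reasoning

    dual : IsBent f → ∀ x →
      let P = prodK (map (λ u → coeff x u ^ (q ℕ.∸ 1)) S-elements) in
      (P ≡ 0# × W f x ≡ ℤ.+ q) ⊎ (P ≡ 1# × W f x ≡ ℤ.- (ℤ.+ q))
    dual bent x with any? (λ u → coeff x u ≟ 0#) S-elements
    ... | yes some-zero =
      let u , u∈ , c≡0 = find some-zero in
      inj₁ (prodK-map-≡0 (Any.map (λ c≡0 → trans (cong (_^ (q ℕ.∸ 1)) c≡0) 0^[q∸1]) some-zero)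
           , walsh-≡q bent x u∈ c≡0)
    ... | no no-zero =
      let nonzero = AllP.¬Any⇒All¬ S-elements no-zero in
      inj₂ (prodK-map-≡1 (All.zipWith (λ (u∈S , c≢0) → InF-^[q∸1] (coeff∈F x u∈S) c≢0) (All.tabulate ∈-S⁻ , nonzero))
           , walsh-≡-q bent x nonzero)

corollary3p2 : (m : ℕ) → 1 ≤ m → (K : FiniteField (2 ℕ.^ m ℕ.* 2 ℕ.^ m)) →
  let open Ops K in let open WithQ m in
  (f : Carrier → Bool) → IsNihoBent f →
  (g : Carrier → Carrier) → (∀ u → InS u → InF (g u)) →
  (∀ l u → InF l → InS u → f (l * u) ≡ tr (l * g u)) →
  ∀ x →
    let P = prodK (map (λ u → (T (x * u) + g u) ^ (q ℕ.∸ 1)) S-elements) in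
    (P ≡ 0# × W f x ≡ ℤ.+ q) ⊎ (P ≡ 1# × W f x ≡ ℤ.- (ℤ.+ q))
corollary3p2 zero () K
corollary3p2 (suc m) (s≤s z≤n) K f (bent , _) g g∈F f-polar =
  NihoBentDual.WalshSpectrum.dual m K f g g∈F f-polar bent
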